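{- Let $\mathcal P$ be a pure $2$-dimensional simplicial poset, let $G\subseteq\mathcal P^{(1)}$ be a bypassing subgraph in $\mathcal P$, and suppose $d_G=d'+d''$ for some metrics $d',d''$ on $\mathcal P$. Let $C$ be a cycle in $G$ with an even number $2n$ of edges, with edge sequence $e_1,\dots,e_{2n}$ and vertex sequence $v_1,\dots,v_{2n}$ (edge $e_i$ joining $v_i$ and $v_{i+1}$, indices modulo $2n$). Suppose that for every $1\le i\le n$ there is an edge $\tilde e_i\in\mathcal P(1)\setminus E(G)$ joining $v_i$ and $v_{i+n}$ such that both walks $e_i,e_{i+1},\dots,e_{i+n-1}$ and $e_{i+n},e_{i+n+1},\dots,e_{i+2n-1}$ (indices modulo $2n$) belong to $B_G(\tilde e_i)$. Then $d'(e_i)=d'(e_{i+n})$ for each $i\in\{1,\dots,n\}$.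
   Context: A simplicial poset is a poset with unique minimum $\hat0$ in which every interval $[\hat0,x]$ is isomorphic to a Boolean lattice; elements whose lower interval is the Boolean lattice on $1,2,3$ elements are vertices, edges, triangles; each edge has two distinct endpoints, each triangle three edge facets. Pure $2$-dimensional: every maximal element is a triangle. $\mathcal P^{(1)}$ is the graph with vertices the vertices and edges the edges of $\mathcal P$. A metric on $\mathcal P$ is a function $d:\mathcal P(1)\to\mathbb R_{\ge0}$ such that for every triangle with facets $e_1,e_2,e_3$: $d(e_1)+d(e_2)\ge d(e_3)$, $d(e_2)+d(e_3)\ge d(e_1)$, $d(e_1)+d(e_3)\ge d(e_2)$. A walk is a sequence of edges $e_1,\dots,e_m$ with vertices $v_1,\dots,v_{m+1}$, $e_i$ having endpoints $v_i,v_{i+1}$; its length is $m$. A path is a walk with no repeated edge; a cycle is a path whose first and last vertices coincide. An elementary contraction replaces two consecutive edges $e_i,e_{i+1}$ of a walk by an edge $\tilde e$ such that $e_i,e_{i+1},\tilde e$ are the three facets of a triangle; a walk can be contracted to $q$ if $q$ results from finitely many (possibly zero) elementary contractions. $G$ is bypassing in $\mathcal P$ if it contains all vertices and each edge $e$ of $\mathcal P$ admits a walk in $G$ contractable to the one-edge walk $e$. $B_G(e)$ is the set of shortest walks in $G$ contractable to $e$; $d_G(e)$ is their common length. -}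

module Defs where

open import Data.Nat using (ℕ; zero; suc) renaming (_+_ to _+ℕ_; _≤_ to _≤ℕ_)
open import Data.Fin.Subset using (Subset; _⊆_)
open import Data.Product using (Σ; ∃; _×_; _,_; proj₁)
open import Data.List using (List; []; _∷_; map; length; upTo; last)
open import Data.List.Relation.Unary.All using (All)
open import Data.List.Relation.Unary.Unique.Propositional using (Unique)
open import Relation.Binary.Structures using (IsPartialOrder; IsTotalOrder)
open import Relation.Binary.PropositionalEquality using (_≡_; _≢_)
open import Relation.Binary.Construct.Closure.ReflexiveTransitive using (Star)
open import Relation.Nullary using (¬_)
open import Data.Unit using (⊤)

-- Values of metrics.  The paper uses ℝ; we work over an arbitrary
-- totally ordered abelian group with a distinguished element 1#
-- (ℝ with 1 is an instance).

record OrderedAbelianGroup : Set₁ where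
  infixl 6 _+_
  infix 4 _≤_
  field
    Carrier       : Set
    _+_           : Carrier → Carrier → Carrier
    0#            : Carrier
    1#            : Carrier
    -_            : Carrier → Carrier
    _≤_           : Carrier → Carrier → Set
    +-assoc       : ∀ x y z → (x + y) + z ≡ x + (y + z)
    +-comm        : ∀ x y → x + y ≡ y + x
    +-identityʳ   : ∀ x → x + 0# ≡ x
    +-inverseʳ    : ∀ x → x + (- x) ≡ 0#
    ≤-isTotalOrder : IsTotalOrder _≡_ _≤_
    +-monoˡ-≤     : ∀ z {x y} → x ≤ y → x + z ≤ y + z
    0<1           : (0# ≤ 1#) × (0# ≢ 1#)

  fromℕ : ℕ → Carrier
  fromℕ zero    = 0#
  fromℕ (suc n) = fromℕ n + 1#

-- [𝟘 , x] is isomorphic (as a poset) to the Boolean lattice of subsets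
-- of a k-element set.
record BooleanInterval {Elt : Set} (_≼_ : Elt → Elt → Set) (x : Elt) (k : ℕ) : Set where
  field
    to      : (y : Elt) → y ≼ x → Subset k
    from    : Subset k → Elt
    from-≼  : ∀ s → from s ≼ x
    from-to : ∀ y (p : y ≼ x) → from (to y p) ≡ y
    to-from : ∀ s → to (from s) (from-≼ s) ≡ s
    to-mono : ∀ y z (p : y ≼ x) (q : z ≼ x) → y ≼ z → to y p ⊆ to z q
    to-refl : ∀ y z (p : y ≼ x) (q : z ≼ x) → to y p ⊆ to z q → y ≼ z

record SimplicialPoset : Set₁ where
  infix 4 _≼_
  field
    Elt            : Set
    _≼_            : Elt → Elt → Set
    isPartialOrder : IsPartialOrder _≡_ _≼_
    𝟘              : Elt
    𝟘-min          : ∀ x → 𝟘 ≼ x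
    boolean        : ∀ x → Σ ℕ (BooleanInterval _≼_ x)

  IsVertex IsEdge IsTriangle : Elt → Set
  IsVertex   x = BooleanInterval _≼_ x 1
  IsEdge     x = BooleanInterval _≼_ x 2
  IsTriangle x = BooleanInterval _≼_ x 3

  Maximal : Elt → Set
  Maximal x = ∀ y → x ≼ y → y ≡ x

  Joins : Elt → Elt → Elt → Set
  Joins e u v = IsEdge e × IsVertex u × IsVertex v × u ≢ v × u ≼ e × v ≼ e

  TriangleFacets : Elt → Elt → Elt → Set
  TriangleFacets a b c =
    Σ Elt λ t → IsTriangle t × IsEdge a × IsEdge b × IsEdge c ×
                a ≼ t × b ≼ t × c ≼ t × a ≢ b × b ≢ c × a ≢ c

  -- Walks: a start vertex v₁ and the list of steps (eᵢ , vᵢ₊₁).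

  record RawWalk : Set where
    constructor walk
    field
      start : Elt
      steps : List (Elt × Elt)

  open RawWalk public

  walkLength : RawWalk → ℕ
  walkLength w = length (steps w)

  edges : RawWalk → List Elt
  edges w = map proj₁ (steps w)

  ValidSteps : Elt → List (Elt × Elt) → Set
  ValidSteps u []            = ⊤
  ValidSteps u ((e , v) ∷ s) = Joins e u v × ValidSteps v s

  IsWalk : RawWalk → Set
  IsWalk w = ValidSteps (start w) (steps w)

  endVertex : RawWalk → Elt
  endVertex w = last' (start w) (steps w)
    where
    last' : Elt → List (Elt × Elt) → Elt
    last' u []            = u
    last' u ((_ , v) ∷ s) = last' v s

  IsPath : RawWalk → Set
  IsPath w = IsWalk w × Unique (edges w)

  IsCycle : RawWalk → Set
  IsCycle w = IsPath w × start w ≡ endVertex w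

  data ElemContr : List (Elt × Elt) → List (Elt × Elt) → Set where
    here  : ∀ {e₁ e₂ ẽ u v rest} → TriangleFacets e₁ e₂ ẽ →
            ElemContr ((e₁ , u) ∷ (e₂ , v) ∷ rest) ((ẽ , v) ∷ rest)
    there : ∀ {x s s'} → ElemContr s s' → ElemContr (x ∷ s) (x ∷ s')

  ContractsTo : RawWalk → Elt → Set
  ContractsTo w e = ∃ λ v → Star ElemContr (steps w) ((e , v) ∷ [])

  segment : (ℕ → Elt) → (ℕ → Elt) → ℕ → ℕ → RawWalk
  segment e v i m = walk (v i) (map (λ k → (e (i +ℕ k) , v (i +ℕ suc k))) (upTo m))

  -- Subgraphs G ⊆ 𝒫⁽¹⁾ containing all vertices: given by their edge set.

  record Subgraph : Set₁ where
    field
      InG    : Elt → Set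
      InG⇒edge : ∀ e → InG e → IsEdge e

  open Subgraph public

  WalkIn : Subgraph → RawWalk → Set
  WalkIn G w = IsWalk w × All (InG G) (edges w)

  Bypassing : Subgraph → Set
  Bypassing G = ∀ e → IsEdge e → ∃ λ w → WalkIn G w × ContractsTo w e

  InB : Subgraph → Elt → RawWalk → Set
  InB G e w = WalkIn G w × ContractsTo w e ×
              (∀ w' → WalkIn G w' → ContractsTo w' e → walkLength w ≤ℕ walkLength w')

  dG≡ : Subgraph → Elt → ℕ → Set
  dG≡ G e n = ∃ λ w → InB G e w × walkLength w ≡ n

module _ (P : SimplicialPoset) where
  open SimplicialPoset P

  Pure2Dim : Set
  Pure2Dim = (∀ x k → BooleanInterval _≼_ x k → k ≤ℕ 3)
           × (∀ x → Maximal x → IsTriangle x)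

  module _ (R : OrderedAbelianGroup) where
    open OrderedAbelianGroup R

    -- metric on 𝒫 (values only matter on edges)
    IsMetric : (Elt → Carrier) → Set
    IsMetric d = (∀ e → IsEdge e → 0# ≤ d e)
               × (∀ e₁ e₂ e₃ → TriangleFacets e₁ e₂ e₃ →
                    (d e₃ ≤ d e₁ + d e₂) × (d e₁ ≤ d e₂ + d e₃) × (d e₂ ≤ d e₁ + d e₃))

{-# OPTIONS --safe #-}
-- For a walk w in B_G(ẽ) every edge lies in G, where d′ + d″ = d_G = 1, so
-- d′(ẽ) + d″(ẽ) = d_G(ẽ) = length w = Σ_w d′ + Σ_w d″. Contracting w to ẽ only uses
-- triangle inequalities, so d′(ẽ) ≤ Σ_w d′ and d″(ẽ) ≤ Σ_w d″; both are therefore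
-- equalities. Hence the two halves of the cycle cut at vᵢ and vᵢ₊ₙ have the same
-- d′-length for every i. Sliding the cut from i to i + 1 changes the two half-lengths
-- by d′(eᵢ₊ₙ) − d′(eᵢ) and d′(eᵢ) − d′(eᵢ₊ₙ) respectively, so twice this difference
-- vanishes, and ordered groups are torsion-free.
module Submission where

open import Defs
open import Data.Nat using (ℕ; _+_; _<_)
open import Data.Product using (Σ; _×_)
open import Relation.Binary.PropositionalEquality using (_≡_)
open import Relation.Nullary using (¬_)

open import Algebra.Bundles using (AbelianGroup)
open import Algebra.Consequences.Propositional using (comm∧idʳ⇒id; comm∧invʳ⇒inv)
import Algebra.Properties.AbelianGroup as AbelianGroupProperties
import Algebra.Properties.CommutativeSemigroup as CommutativeSemigroupProperties
import Algebra.Solver.CommutativeMonoid as CommutativeMonoidSolver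
open import Data.List using (List; []; _∷_; map; length; applyUpTo)
open import Data.List.Relation.Unary.All using (All; []; _∷_)
open import Data.Nat using (zero; suc; s≤s; z≤n)
import Data.Nat.Properties as ℕ
open import Data.Product using (_,_; proj₁; proj₂)
open import Data.Sum using (inj₁; inj₂)
open import Data.Unit using (tt)
open import Function using (_∘_; id)
open import Level using (0ℓ)
open import Relation.Binary.Construct.Closure.ReflexiveTransitive using (ε; _◅_; fold)
open import Relation.Binary.PropositionalEquality
  using (refl; sym; trans; cong; cong₂; isEquivalence; module ≡-Reasoning)
open import Relation.Binary.Structures using (IsTotalOrder)

module OrderedAbelianGroupProperties (R : OrderedAbelianGroup) where
  open OrderedAbelianGroup R renaming (_+_ to _⊕_)
  open IsTotalOrder ≤-isTotalOrder public
    using (total; antisym; reflexive) renaming (refl to ≤-refl; trans to ≤-trans)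

  abelianGroup : AbelianGroup 0ℓ 0ℓ
  abelianGroup = record
    { isAbelianGroup = record
      { isGroup = record
        { isMonoid = record
          { isSemigroup = record
            { isMagma = record { isEquivalence = isEquivalence ; ∙-cong = cong₂ _⊕_ }
            ; assoc = +-assoc }
          ; identity = comm∧idʳ⇒id +-comm +-identityʳ }
        ; inverse = comm∧invʳ⇒inv +-comm +-inverseʳ
        ; ⁻¹-cong = cong -_ }
      ; comm = +-comm } }

  open AbelianGroup abelianGroup using (commutativeMonoid; commutativeSemigroup)
  open AbelianGroupProperties abelianGroup using (∙-cancelʳ)
  open CommutativeSemigroupProperties commutativeSemigroup public using (interchange)
  open CommutativeMonoidSolver commutativeMonoid using (solve; _⊜_) renaming (_⊕_ to _⊞_)

  +-monoʳ-≤ : ∀ z {x y} → x ≤ y → z ⊕ x ≤ z ⊕ y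
  +-monoʳ-≤ z {x} {y} x≤y rewrite +-comm z x | +-comm z y = +-monoˡ-≤ z x≤y

  ≤∧≤∧+≡⇒≡ˡ : ∀ {a b x y} → a ≤ x → b ≤ y → a ⊕ b ≡ x ⊕ y → a ≡ x
  ≤∧≤∧+≡⇒≡ˡ {a} {b} {x} a≤x b≤y ab≡xy = ∙-cancelʳ b a x
    (antisym (+-monoˡ-≤ b a≤x) (≤-trans (+-monoʳ-≤ x b≤y) (reflexive (sym ab≡xy))))

  double-injective : ∀ {a b} → a ⊕ a ≡ b ⊕ b → a ≡ b
  double-injective {a} {b} aa≡bb with total a b
  ... | inj₁ a≤b = ≤∧≤∧+≡⇒≡ˡ a≤b a≤b aa≡bb
  ... | inj₂ b≤a = sym (≤∧≤∧+≡⇒≡ˡ b≤a b≤a (sym aa≡bb))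

  swapped-sums⇒double≡ : ∀ {a b x y} → x ⊕ b ≡ a ⊕ y → x ⊕ a ≡ b ⊕ y → a ⊕ a ≡ b ⊕ b
  swapped-sums⇒double≡ {a} {b} {x} {y} xb≡ay xa≡by = ∙-cancelʳ (x ⊕ y) (a ⊕ a) (b ⊕ b) (begin
    (a ⊕ a) ⊕ (x ⊕ y)  ≡⟨ solve 3 (λ a x y → (a ⊞ a) ⊞ (x ⊞ y) ⊜ (x ⊞ a) ⊞ (a ⊞ y)) refl a x y ⟩
    (x ⊕ a) ⊕ (a ⊕ y)  ≡⟨ cong₂ _⊕_ xa≡by (sym xb≡ay) ⟩
    (b ⊕ y) ⊕ (x ⊕ b)  ≡⟨ solve 3 (λ b x y → (b ⊞ y) ⊞ (x ⊞ b) ⊜ (b ⊞ b) ⊞ (x ⊞ y)) refl b x y ⟩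
    (b ⊕ b) ⊕ (x ⊕ y)  ∎)
    where open ≡-Reasoning

  swapped-sums⇒≡ : ∀ {a b x y} → x ⊕ b ≡ a ⊕ y → x ⊕ a ≡ b ⊕ y → a ≡ b
  swapped-sums⇒≡ xb≡ay xa≡by = double-injective (swapped-sums⇒double≡ xb≡ay xa≡by)

  partialSum : (ℕ → Carrier) → ℕ → Carrier
  partialSum f zero    = 0#
  partialSum f (suc m) = f 0 ⊕ partialSum (f ∘ suc) m

  partialSum-cong : ∀ {f g} m → (∀ k → f k ≡ g k) → partialSum f m ≡ partialSum g m
  partialSum-cong zero    f≗g = refl
  partialSum-cong (suc m) f≗g = cong₂ _⊕_ (f≗g 0) (partialSum-cong m (f≗g ∘ suc))

  partialSum-rotate : ∀ f m → partialSum f m ⊕ f m ≡ f 0 ⊕ partialSum (f ∘ suc) m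
  partialSum-rotate f zero    = +-comm 0# (f 0)
  partialSum-rotate f (suc m) = begin
    (f 0 ⊕ partialSum (f ∘ suc) m) ⊕ f (suc m)  ≡⟨ +-assoc (f 0) _ _ ⟩
    f 0 ⊕ (partialSum (f ∘ suc) m ⊕ f (suc m))  ≡⟨ cong (f 0 ⊕_) (partialSum-rotate (f ∘ suc) m) ⟩
    f 0 ⊕ partialSum (f ∘ suc) (suc m)          ∎
    where open ≡-Reasoning

  window : (ℕ → Carrier) → ℕ → ℕ → Carrier
  window A j m = partialSum (λ k → A (j + k)) m

  window-slide : ∀ A j m → window A j m ⊕ A (j + m) ≡ A j ⊕ window A (suc j) m
  window-slide A j m = begin
    window A j m ⊕ A (j + m)                        ≡⟨ partialSum-rotate (λ k → A (j + k)) m ⟩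
    A (j + 0) ⊕ partialSum (λ k → A (j + suc k)) m  ≡⟨ cong₂ _⊕_ (cong A (ℕ.+-identityʳ j))
                                                         (partialSum-cong m (cong A ∘ ℕ.+-suc j)) ⟩
    A j ⊕ window A (suc j) m                        ∎
    where open ≡-Reasoning

  window-periodic : ∀ A p m → (∀ i → A (i + p) ≡ A i) → window A p m ≡ window A 0 m
  window-periodic A p m A-periodic =
    partialSum-cong m (λ k → trans (cong A (ℕ.+-comm p k)) (A-periodic k))

  module _ (A : ℕ → Carrier) (n : ℕ) (A-periodic : ∀ i → A (i + (n + n)) ≡ A i)
           (antipodal-windows : ∀ i → i < n → window A i n ≡ window A (i + n) n) where

    next-antipodal-windows : ∀ i → i < n → window A (suc i) n ≡ window A (suc i + n) n
    next-antipodal-windows i i<n with ℕ.m≤n⇒m<n∨m≡n i<n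
    ... | inj₁ 1+i<n = antipodal-windows (suc i) 1+i<n
    ... | inj₂ refl  = begin
      window A n n        ≡⟨ antipodal-windows 0 (ℕ.m<n⇒0<n i<n) ⟨
      window A 0 n        ≡⟨ window-periodic A (n + n) n A-periodic ⟨
      window A (n + n) n  ∎
      where open ≡-Reasoning

    antipodal-terms : ∀ i → i < n → A i ≡ A (i + n)
    antipodal-terms i i<n = swapped-sums⇒≡ (window-slide A i n) (begin
      window A i n ⊕ A i                    ≡⟨ cong₂ _⊕_ (antipodal-windows i i<n) (sym (A-periodic i)) ⟩
      window A (i + n) n ⊕ A (i + (n + n))  ≡⟨ cong (λ k → window A (i + n) n ⊕ A k) (ℕ.+-assoc i n n) ⟨
      window A (i + n) n ⊕ A (i + n + n)    ≡⟨ window-slide A (i + n) n ⟩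
      A (i + n) ⊕ window A (suc i + n) n    ≡⟨ cong (A (i + n) ⊕_) (next-antipodal-windows i i<n) ⟨
      A (i + n) ⊕ window A (suc i) n        ∎)
      where open ≡-Reasoning

module WalkWeight (P : SimplicialPoset) (R : OrderedAbelianGroup) where
  open SimplicialPoset P
  open OrderedAbelianGroup R renaming (_+_ to _⊕_)
  open OrderedAbelianGroupProperties R

  weight : (Elt → Carrier) → List (Elt × Elt) → Carrier
  weight d []            = 0#
  weight d ((e , _) ∷ s) = d e ⊕ weight d s

  weight-map-applyUpTo : ∀ d (g : ℕ → Elt × Elt) f m →
                         weight d (map g (applyUpTo f m)) ≡ partialSum (d ∘ proj₁ ∘ g ∘ f) m
  weight-map-applyUpTo d g f zero    = refl
  weight-map-applyUpTo d g f (suc m) = cong (d (proj₁ (g (f 0))) ⊕_) (weight-map-applyUpTo d g (f ∘ suc) m)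

  weight-segment : ∀ d e v i m → weight d (steps (segment e v i m)) ≡ window (d ∘ e) i m
  weight-segment d e v i m = weight-map-applyUpTo d (λ k → e (i + k) , v (i + suc k)) id m

  module _ {d : Elt → Carrier} (d-metric : IsMetric P R d) where

    weight-mono-ElemContr : ∀ {s t} → ElemContr s t → weight d t ≤ weight d s
    weight-mono-ElemContr {(e₁ , _) ∷ (e₂ , _) ∷ s} (here {ẽ = ẽ} facets) = ≤-trans
      (+-monoˡ-≤ (weight d s) (proj₁ (proj₂ d-metric e₁ e₂ ẽ facets)))
      (reflexive (+-assoc (d e₁) (d e₂) (weight d s)))
    weight-mono-ElemContr {(e , _) ∷ _} (there c) = +-monoʳ-≤ (d e) (weight-mono-ElemContr c)

    ContractsTo⇒≤weight : ∀ w {e} → ContractsTo w e → d e ≤ weight d (steps w)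
    ContractsTo⇒≤weight _ {e} (_ , contraction) = ≤-trans
      (reflexive (sym (+-identityʳ (d e))))
      (fold (λ s t → weight d t ≤ weight d s) (λ c t≤s → ≤-trans t≤s (weight-mono-ElemContr c)) ≤-refl contraction)

module Geodesics (P : SimplicialPoset) (R : OrderedAbelianGroup) (G : SimplicialPoset.Subgraph P) where
  open SimplicialPoset P
  open OrderedAbelianGroup R renaming (_+_ to _⊕_)
  open OrderedAbelianGroupProperties R
  open WalkWeight P R

  ContractsTo⇒nonempty : ∀ w {e} → ContractsTo w e → 0 < walkLength w
  ContractsTo⇒nonempty (walk _ (_ ∷ _)) _ = s≤s z≤n
  ContractsTo⇒nonempty (walk _ []) (_ , () ◅ _)

  InG⇒dG≡1 : ∀ {e u v} → Joins e u v → InG G e → dG≡ G e 1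
  InG⇒dG≡1 {e} {u} {v} e-joins e∈G =
    walk u ((e , v) ∷ []) , (((e-joins , tt) , e∈G ∷ []) , (v , ε) , λ w _ → ContractsTo⇒nonempty w) , refl

  module _ (d′ d″ : Elt → Carrier)
           (dG-split : ∀ e → IsEdge e → ∀ k → dG≡ G e k → d′ e ⊕ d″ e ≡ fromℕ k) where

    weight-split : ∀ {u} s → ValidSteps u s → All (InG G) (map proj₁ s) →
                   weight d′ s ⊕ weight d″ s ≡ fromℕ (length s)
    weight-split []            _                 _          = +-identityʳ 0#
    weight-split ((e , v) ∷ s) (e-joins , valid) (e∈G ∷ s⊆G) = begin
      (d′ e ⊕ weight d′ s) ⊕ (d″ e ⊕ weight d″ s)  ≡⟨ interchange (d′ e) _ (d″ e) _ ⟩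
      (d′ e ⊕ d″ e) ⊕ (weight d′ s ⊕ weight d″ s)  ≡⟨ cong₂ _⊕_ edge-split (weight-split s valid s⊆G) ⟩
      fromℕ 1 ⊕ fromℕ (length s)                   ≡⟨ +-comm _ _ ⟩
      fromℕ (length s) ⊕ (0# ⊕ 1#)                 ≡⟨ cong (fromℕ (length s) ⊕_) (trans (+-comm 0# 1#) (+-identityʳ 1#)) ⟩
      fromℕ (length s) ⊕ 1#                        ∎
      where
      open ≡-Reasoning
      edge-split : d′ e ⊕ d″ e ≡ fromℕ 1
      edge-split = dG-split e (proj₁ e-joins) 1 (InG⇒dG≡1 e-joins e∈G)

    InB⇒≡weight : IsMetric P R d′ → IsMetric P R d″ →
                  ∀ {ẽ w} → IsEdge ẽ → InB G ẽ w → d′ ẽ ≡ weight d′ (steps w)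
    InB⇒≡weight d′-metric d″-metric {ẽ} {w} ẽ-edge geodesic@((valid , w⊆G) , contraction , _) =
      ≤∧≤∧+≡⇒≡ˡ (ContractsTo⇒≤weight d′-metric w contraction) (ContractsTo⇒≤weight d″-metric w contraction)
        (trans (dG-split ẽ ẽ-edge (walkLength w) (w , geodesic , refl))
               (sym (weight-split (steps w) valid w⊆G)))

corollary4p8 :
  (P : SimplicialPoset) → Pure2Dim P →
  (R : OrderedAbelianGroup) →
  let open SimplicialPoset P
      open OrderedAbelianGroup R renaming (_+_ to _⊕_)
  in (G : Subgraph) → Bypassing G →
     (d′ d″ : Elt → Carrier) → IsMetric P R d′ → IsMetric P R d″ →
     (∀ e → IsEdge e → ∀ k → dG≡ G e k → d′ e ⊕ d″ e ≡ fromℕ k) →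
     (n : ℕ) (e v : ℕ → Elt) →
     (∀ i → e (i + (n + n)) ≡ e i) → (∀ i → v (i + (n + n)) ≡ v i) →
     IsCycle (segment e v 0 (n + n)) → WalkIn G (segment e v 0 (n + n)) →
     (∀ i → i < n → Σ Elt λ ẽ → Joins ẽ (v i) (v (i + n)) × ¬ InG G ẽ ×
          InB G ẽ (segment e v i n) × InB G ẽ (segment e v (i + n) n)) →
     ∀ i → i < n → d′ (e i) ≡ d′ (e (i + n))
corollary4p8 P _ R G _ d′ d″ d′-metric d″-metric dG-split n e v e-periodic _ _ _ antipodal-geodesics =
  antipodal-terms (d′ ∘ e) n (cong d′ ∘ e-periodic) antipodal-windows
  where
  open SimplicialPoset P using (IsEdge; InB; steps; segment)
  open OrderedAbelianGroupProperties R
  open WalkWeight P R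
  open Geodesics P R G

  geodesic-weight : ∀ {ẽ w} → IsEdge ẽ → InB G ẽ w → d′ ẽ ≡ weight d′ (steps w)
  geodesic-weight = InB⇒≡weight d′ d″ dG-split d′-metric d″-metric

  antipodal-windows : ∀ i → i < n → window (d′ ∘ e) i n ≡ window (d′ ∘ e) (i + n) n
  antipodal-windows i i<n with antipodal-geodesics i i<n
  ... | ẽ , ẽ-joins , _ , geodesic , antipodal-geodesic = begin
    window (d′ ∘ e) i n                        ≡⟨ weight-segment d′ e v i n ⟨
    weight d′ (steps (segment e v i n))        ≡⟨ geodesic-weight (proj₁ ẽ-joins) geodesic ⟨
    d′ ẽ                                       ≡⟨ geodesic-weight (proj₁ ẽ-joins) antipodal-geodesic ⟩
    weight d′ (steps (segment e v (i + n) n))  ≡⟨ weight-segment d′ e v (i + n) n ⟩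
    window (d′ ∘ e) (i + n) n                  ∎
    where open ≡-Reasoning
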